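{- Let $G$ be a $2$-connected multigraph. Suppose $u_1,u_2,w\in V(G)$ are distinct vertices such that $G-u_1-u_2$ is connected, $e_G(u_1,u_2)<e_G(u_1,w)$, and $e_G(u_2,w)\ge 1$. Then $G$ is DP-degree-colorable.
   Context: For a multigraph $G$ (no loops) and distinct $u,v\in V(G)$, $e_G(u,v)$ is the number of edges joining $u$ and $v$, and $\deg_G(v)=\sum_{u\neq v}e_G(v,u)$. A cover of $G$ is a pair $(L,H)$ where $L$ assigns pairwise disjoint sets $L(v)$ to the vertices and $H$ is a simple graph on $\bigcup_v L(v)$ such that each $H[L(v)]$ is complete and for distinct $u,v$ the edges of $H$ between $L(u)$ and $L(v)$ form the union of $e_G(u,v)$ (possibly empty) matchings. An $(L,H)$-coloring is an independent set of $H$ of size $|V(G)|$. $G$ is DP-degree-colorable if it has an $(L,H)$-coloring for every cover with $|L(v)|\ge\deg_G(v)$ for all $v$. -}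

module Defs where

open import Data.Nat using (ℕ; zero; suc; _≤_; _<_)
open import Data.Fin using (Fin; _≟_)
open import Data.List using (List; map; allFin)
open import Data.Nat.ListAction using (sum)
open import Data.Bool using (Bool; true; false; if_then_else_)
open import Data.Product using (Σ; _×_; _,_; ∃)
open import Data.Sum using (_⊎_)
open import Relation.Nullary using (¬_)
open import Relation.Nullary.Decidable using (⌊_⌋)
open import Relation.Binary.PropositionalEquality using (_≡_; _≢_)
open import Function.Definitions using (Injective)

_⇔'_ : Set → Set → Set
A ⇔' B = (A → B) × (B → A)
infix 3 _⇔'_

record Multigraph : Set where
  field
    n      : ℕ
    e      : Fin n → Fin n → ℕ
    e-sym  : ∀ u v → e u v ≡ e v u
    e-loop : ∀ v → e v v ≡ 0

module _ (G : Multigraph) where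
  open Multigraph G

  deg : Fin n → ℕ
  deg v = sum (map (λ u → if ⌊ u ≟ v ⌋ then 0 else e v u) (allFin n))

  data Walk (S : Fin n → Set) : Fin n → Fin n → Set where
    here : ∀ {x} → S x → Walk S x x
    step : ∀ {x y z} → S x → 0 < e x y → Walk S y z → Walk S x z

  ConnectedOn : (Fin n → Set) → Set
  ConnectedOn S = ∀ x y → S x → S y → Walk S x y

  Connected : Set
  Connected = ConnectedOn (λ _ → Fin n)

  TwoConnected : Set
  TwoConnected = (3 ≤ n) × Connected × (∀ v → ConnectedOn (λ x → x ≢ v))

  IsMatching : {A B : Set} → (A → B → Bool) → Set
  IsMatching M = (∀ a b b' → M a b ≡ true → M a b' ≡ true → b ≡ b')
               × (∀ a a' b → M a b ≡ true → M a' b ≡ true → a ≡ a')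

  -- A cover (L,H) with |L(v)| = k v. L(v) = {v} × Fin (k v) (disjoint by
  -- construction); each H[L(v)] is complete; crossH u v records the edges of H
  -- between L(u) and L(v) for u ≠ v.
  record Cover (k : Fin n → ℕ) : Set where
    field
      crossH     : (u v : Fin n) → Fin (k u) → Fin (k v) → Bool
      crossH-sym : ∀ u v a b → crossH u v a b ≡ crossH v u b a
      matchings  : ∀ u v → u ≢ v →
                   Σ (Fin (e u v) → Fin (k u) → Fin (k v) → Bool) λ M →
                     (∀ i → IsMatching (M i)) ×
                     (∀ a b → crossH u v a b ≡ true ⇔' ∃ λ i → M i a b ≡ true)

    Colour : Set
    Colour = Σ (Fin n) λ v → Fin (k v)

    Adj : Colour → Colour → Set
    Adj (u , a) (v , b) =
      (u ≡ v × (u , a) ≢ (v , b)) ⊎ (u ≢ v × crossH u v a b ≡ true)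

    -- an (L,H)-coloring: an independent set of H of size |V(G)|,
    -- given as the image of an injection Fin n → colours
    Coloring : Set
    Coloring = Σ (Fin n → Colour) λ f →
                 Injective _≡_ _≡_ f × (∀ i j → ¬ Adj (f i) (f j))

  DPDegreeColorable : Set
  DPDegreeColorable = ∀ (k : Fin n → ℕ) → (∀ v → deg v ≤ k v) →
                      (C : Cover k) → Cover.Coloring C

-- Call a set S of uncoloured vertices degenerate for an independent partial colouring φ if every
-- v ∈ S has at least (colours of L(v) forbidden by φ) + d_S(v) colours, and every v ∈ S reaches,
-- inside S, a vertex where this is strict. Such an S can be coloured: remove a vertex s₀ with slack;
-- its neighbours in S gain slack, so S − s₀ is again degenerate; colour it recursively and s₀ last.
-- As the edges between L(u) and L(v) form e(u,v) matchings, a precoloured u forbids at most e(u,v)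
-- colours at v. Hence a precolouring of P with G − P connected extends to an (L,H)-colouring as soon
-- as some s ∉ P has fewer than d_P(s) forbidden colours.
--
-- If some x ∈ L(w) has fewer than e(u₁,w) neighbours in L(u₁), precolour w by x (G − w is connected)
-- and take s = u₁. Otherwise fix c₂ ∈ L(u₂). If c₂ has no neighbour in L(w), precolour u₂ by c₂ and
-- take s = w. Otherwise c₂ ~ x ∈ L(w), and x has at least e(u₁,w) > e(u₁,u₂) neighbours in L(u₁),
-- more than c₂ has; so some c₁ ∈ L(u₁) is adjacent to x but not to c₂. Precolouring u₁, u₂ by c₁, c₂
-- forbids x twice at w, so w has fewer than e(w,u₁) + e(w,u₂) forbidden colours.

module Submission where

open import Data.Bool using (Bool; true; false; not; _∧_; _∨_; if_then_else_)
import Data.Bool.Properties as Bool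
open import Data.Fin using (Fin; zero; suc; _≟_; fromℕ<; punchIn)
open import Data.Fin.Properties using (any?; punchInᵢ≢i)
open import Data.List using (tabulate)
import Data.List.Properties as List
import Data.Nat.ListAction as List
open import Data.Maybe using (Maybe; just; nothing; is-just)
open import Data.Maybe.Properties using (just-injective)
open import Data.Nat using (ℕ; zero; suc; _+_; _≤_; _<_; z≤n; s≤s; _<?_)
open import Data.Nat.Properties hiding (_≟_)
open import Algebra.Properties.CommutativeMonoid.Sum +-0-commutativeMonoid
  using (sum; sum-syntax; ∑-distrib-+; sum-cong-≗; sum-remove; sum-replicate-zero)
open import Data.Product using (∃; _×_; _,_; proj₁; proj₂)
open import Data.Sum using (_⊎_; inj₁; inj₂)
open import Data.Vec.Functional using (foldr)
open import Function using (_∘_; id)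
open import Relation.Nullary using (¬_; yes; no; does; contradiction)
open import Relation.Nullary.Decidable using (⌊_⌋; dec-true; dec-false; _×-dec_)
open import Relation.Binary.PropositionalEquality

open import Defs

-- Sums and counting over Fin

∑-mono-≤ : ∀ {m} {f g : Fin m → ℕ} → (∀ i → f i ≤ g i) → sum f ≤ sum g
∑-mono-≤ {zero}  f≤g = z≤n
∑-mono-≤ {suc m} f≤g = +-mono-≤ (f≤g zero) (∑-mono-≤ (f≤g ∘ suc))

∑-mono-< : ∀ {m} {f g : Fin m → ℕ} → (∀ i → f i ≤ g i) → ∀ x → f x < g x → sum f < sum g
∑-mono-< f≤g zero    fx<gx = +-mono-<-≤ fx<gx (∑-mono-≤ (f≤g ∘ suc))
∑-mono-< f≤g (suc x) fx<gx = +-mono-≤-< (f≤g zero) (∑-mono-< (f≤g ∘ suc) x fx<gx)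

∑-single : ∀ {m} (f : Fin m → ℕ) (p : Fin m) → (∀ i → i ≢ p → f i ≡ 0) → sum f ≡ f p
∑-single {suc m} f p f≡0 = begin
  sum f                     ≡⟨ sum-remove f ⟩
  f p + sum (f ∘ punchIn p) ≡⟨ cong (f p +_) (sum-cong-≗ (λ j → f≡0 _ (punchInᵢ≢i p j))) ⟩
  f p + ∑[ _ < m ] 0        ≡⟨ cong (f p +_) (sum-replicate-zero m) ⟩
  f p + 0                   ≡⟨ +-identityʳ (f p) ⟩
  f p                       ∎
  where open ≡-Reasoning

List-sum-tabulate : ∀ {m} (f : Fin m → ℕ) → List.sum (tabulate f) ≡ sum f
List-sum-tabulate {zero}  f = refl
List-sum-tabulate {suc m} f = cong (f zero +_) (List-sum-tabulate (f ∘ suc))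

indicator : Bool → ℕ
indicator b = if b then 1 else 0

indicator-mono : ∀ {a b} → (a ≡ true → b ≡ true) → indicator a ≤ indicator b
indicator-mono {false} a⇒b = z≤n
indicator-mono {true}  a⇒b rewrite a⇒b refl = ≤-refl

indicator-∨ : ∀ a b → indicator (a ∨ b) ≤ indicator a + indicator b
indicator-∨ true  b = s≤s z≤n
indicator-∨ false b = ≤-refl

count : ∀ {m} → (Fin m → Bool) → ℕ
count {m} f = ∑[ i < m ] indicator (f i)

_⊆_ : ∀ {m} → (Fin m → Bool) → (Fin m → Bool) → Set
f ⊆ g = ∀ i → f i ≡ true → g i ≡ true

⁅_⁆ : ∀ {m} → Fin m → Fin m → Bool
⁅ p ⁆ i = does (i ≟ p)

count-∅ : ∀ {m} → count {m} (λ _ → false) ≡ 0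
count-∅ {m} = sum-replicate-zero m

count-⊤ : ∀ {m} → count {m} (λ _ → true) ≡ m
count-⊤ {zero}  = refl
count-⊤ {suc m} = cong suc (count-⊤ {m})

count-⁅⁆ : ∀ {m} (p : Fin m) → count ⁅ p ⁆ ≡ 1
count-⁅⁆ p = begin
  count ⁅ p ⁆          ≡⟨ ∑-single _ p (λ i i≢p → cong indicator (dec-false (i ≟ p) i≢p)) ⟩
  indicator (⁅ p ⁆ p)  ≡⟨ cong indicator (dec-true (p ≟ p) refl) ⟩
  1                    ∎
  where open ≡-Reasoning

count-mono : ∀ {m} {f g : Fin m → Bool} → f ⊆ g → count f ≤ count g
count-mono f⊆g = ∑-mono-≤ (λ i → indicator-mono (f⊆g i))

count-≤ : ∀ {m} (f : Fin m → Bool) → count f ≤ m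
count-≤ {m} f = ≤-trans (count-mono {m} {f} {λ _ → true} (λ _ _ → refl)) (≤-reflexive count-⊤)

count-< : ∀ {m} {f g : Fin m → Bool} → f ⊆ g → ∀ x → g x ≡ true → f x ≡ false → count f < count g
count-< f⊆g x gx fx = ∑-mono-< (λ i → indicator-mono (f⊆g i)) x
  (subst₂ (λ a b → indicator a < indicator b) (sym fx) (sym gx) ≤-refl)

count-∨ : ∀ {m} (f g : Fin m → Bool) → count (λ i → f i ∨ g i) ≤ count f + count g
count-∨ f g = ≤-trans (∑-mono-≤ (λ i → indicator-∨ (f i) (g i)))
                      (≤-reflexive (∑-distrib-+ (indicator ∘ f) (indicator ∘ g)))

count-∨-< : ∀ {m} (f g : Fin m → Bool) → ∀ x → f x ≡ true → g x ≡ true →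
            count (λ i → f i ∨ g i) < count f + count g
count-∨-< f g x fx gx = ≤-trans
  (∑-mono-< (λ i → indicator-∨ (f i) (g i)) x
    (subst₂ (λ a b → indicator (a ∨ b) < indicator a + indicator b) (sym fx) (sym gx) ≤-refl))
  (≤-reflexive (∑-distrib-+ (indicator ∘ f) (indicator ∘ g)))

count-<⇒∃ : ∀ {m} {f g : Fin m → Bool} → count f < count g → ∃ λ i → g i ≡ true × f i ≡ false
count-<⇒∃ {f = f} {g} f<g with any? (λ i → g i Bool.≟ true ×-dec f i Bool.≟ false)
... | yes found = found
... | no none   = contradiction (count-mono g⊆f) (<⇒≱ f<g)
  where
  g⊆f : g ⊆ f
  g⊆f i gi with f i in fi
  ... | true  = refl
  ... | false = contradiction (i , gi , fi) none

count-∄ : ∀ {m} {f : Fin m → Bool} → ¬ (∃ λ i → f i ≡ true) → count f ≡ 0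
count-∄ {m} none = n≤0⇒n≡0 (≤-trans (count-mono {g = λ _ → false} (λ i fi → contradiction (i , fi) none))
                                    (≤-reflexive (count-∅ {m})))

count-≤1 : ∀ {m} (f : Fin m → Bool) → (∀ i j → f i ≡ true → f j ≡ true → i ≡ j) → count f ≤ 1
count-≤1 f unique with any? (λ i → f i Bool.≟ true)
... | yes (i , fi) = ≤-trans (count-mono (λ j fj → dec-true (j ≟ i) (unique j i fj fi)))
                             (≤-reflexive (count-⁅⁆ i))
... | no none      = ≤-trans (≤-reflexive (count-∄ none)) z≤n

_∖_ : ∀ {m} → (Fin m → Bool) → Fin m → Fin m → Bool
(S ∖ t) u = S u ∧ not (⁅ t ⁆ u)

∖-⊆ : ∀ {m} (S : Fin m → Bool) t → (S ∖ t) ⊆ S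
∖-⊆ S t u h with S u
... | true  = refl
... | false = h

∖-self : ∀ {m} (S : Fin m → Bool) t → (S ∖ t) t ≡ false
∖-self S t rewrite dec-true (t ≟ t) refl = Bool.∧-zeroʳ (S t)

∖-≢ : ∀ {m} (S : Fin m → Bool) {t u} → (S ∖ t) u ≡ true → u ≢ t
∖-≢ S {t} h refl = contradiction (trans (sym h) (∖-self S t)) λ ()

∈-∖ : ∀ {m} (S : Fin m → Bool) {t u} → S u ≡ true → u ≢ t → (S ∖ t) u ≡ true
∈-∖ S {t} {u} Su u≢t rewrite Su | dec-false (u ≟ t) u≢t = refl

∖-∪-⁅⁆ : ∀ {m} (S : Fin m → Bool) {t} → S t ≡ true → ∀ u → S u ≡ (S ∖ t) u ∨ ⁅ t ⁆ u
∖-∪-⁅⁆ S {t} St u with u ≟ t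
... | yes refl rewrite St = refl
... | no _ rewrite Bool.∧-identityʳ (S u) = sym (Bool.∨-identityʳ (S u))

any : ∀ {m} → (Fin m → Bool) → Bool
any = foldr _∨_ false

any-intro : ∀ {m} {f : Fin m → Bool} → (∃ λ i → f i ≡ true) → any f ≡ true
any-intro             (zero  , fi) rewrite fi = refl
any-intro {f = f} (suc i , fi) rewrite any-intro {f = f ∘ suc} (i , fi) = Bool.∨-zeroʳ (f zero)

any-elim : ∀ {m} {f : Fin m → Bool} → any f ≡ true → ∃ λ i → f i ≡ true
any-elim {suc m} {f} any-f with f zero in f0
... | true  = zero , f0
... | false = let i , fi = any-elim any-f in suc i , fi

any-false : ∀ {m} {f : Fin m → Bool} → any f ≡ false → ∀ i → f i ≡ false
any-false {f = f} none i with f i in fi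
... | false = refl
... | true  = contradiction (trans (sym (any-intro (i , fi))) none) λ ()

count-any : ∀ {l m} (P : Fin l → Fin m → Bool) → count (λ b → any (λ u → P u b)) ≤ ∑[ u < l ] count (P u)
count-any {zero} {m} P = ≤-reflexive (count-∅ {m})
count-any {suc l} P = ≤-trans (count-∨ (P zero) _) (+-monoʳ-≤ _ (count-any (P ∘ suc)))

-- Degrees into vertex sets, and walks

module _ (G : Multigraph) where
  open Multigraph G

  degInto : (Fin n → Bool) → Fin n → ℕ
  degInto S v = ∑[ u < n ] (if S u then e v u else 0)

  deg≡∑ : ∀ v → deg G v ≡ ∑[ u < n ] e v u
  deg≡∑ v = begin
    deg G v                             ≡⟨ cong List.sum (List.map-tabulate id term) ⟩
    List.sum (tabulate term)            ≡⟨ List-sum-tabulate term ⟩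
    ∑[ u < n ] term u                   ≡⟨ sum-cong-≗ term≡e ⟩
    ∑[ u < n ] e v u                    ∎
    where
    open ≡-Reasoning
    term : Fin n → ℕ
    term u = if ⌊ u ≟ v ⌋ then 0 else e v u
    term≡e : ∀ u → term u ≡ e v u
    term≡e u with u ≟ v
    ... | yes refl = sym (e-loop v)
    ... | no _     = refl

  deg-split : ∀ S v → degInto S v + degInto (not ∘ S) v ≡ deg G v
  deg-split S v = begin
    degInto S v + degInto (not ∘ S) v  ≡⟨ ∑-distrib-+ (part S) (part (not ∘ S)) ⟨
    ∑[ u < n ] (part S u + part (not ∘ S) u) ≡⟨ sum-cong-≗ parts ⟩
    ∑[ u < n ] e v u                    ≡⟨ deg≡∑ v ⟨
    deg G v                             ∎
    where
    open ≡-Reasoning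
    part : (Fin n → Bool) → Fin n → ℕ
    part T u = if T u then e v u else 0
    parts : ∀ u → part S u + part (not ∘ S) u ≡ e v u
    parts u with S u
    ... | true  = +-identityʳ (e v u)
    ... | false = refl

  degInto-mono : ∀ {S T} → S ⊆ T → ∀ v → degInto S v ≤ degInto T v
  degInto-mono {S} {T} S⊆T v = ∑-mono-≤ part-mono
    where
    part-mono : ∀ u → (if S u then e v u else 0) ≤ (if T u then e v u else 0)
    part-mono u with S u in Su
    ... | false = z≤n
    ... | true rewrite S⊆T u Su = ≤-refl

  degInto-∅ : ∀ v → degInto (λ _ → false) v ≡ 0
  degInto-∅ _ = sum-replicate-zero n

  degInto-⁅⁆ : ∀ t v → degInto ⁅ t ⁆ v ≡ e v t
  degInto-⁅⁆ t v = begin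
    degInto ⁅ t ⁆ v
      ≡⟨ ∑-single _ t (λ u u≢t → cong (λ b → if b then e v u else 0) (dec-false (u ≟ t) u≢t)) ⟩
    (if ⁅ t ⁆ t then e v t else 0)
      ≡⟨ cong (λ b → if b then e v t else 0) (dec-true (t ≟ t) refl) ⟩
    e v t
      ∎
    where open ≡-Reasoning

  e≤deg : ∀ v u → e v u ≤ deg G v
  e≤deg v u = begin
    e v u                                      ≡⟨ degInto-⁅⁆ u v ⟨
    degInto ⁅ u ⁆ v                            ≤⟨ m≤m+n _ _ ⟩
    degInto ⁅ u ⁆ v + degInto (not ∘ ⁅ u ⁆) v  ≡⟨ deg-split ⁅ u ⁆ v ⟩
    deg G v                                    ∎
    where open ≤-Reasoning

  degInto-insert : ∀ {S T} t v → (∀ u → T u ≡ S u ∨ ⁅ t ⁆ u) → S t ≡ false →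
                   degInto T v ≡ degInto S v + e v t
  degInto-insert {S} {T} t v T≡S∪t St = begin
    degInto T v                                          ≡⟨ sum-cong-≗ parts ⟩
    ∑[ u < n ] (part S u + part ⁅ t ⁆ u)                 ≡⟨ ∑-distrib-+ (part S) (part ⁅ t ⁆) ⟩
    degInto S v + degInto ⁅ t ⁆ v                        ≡⟨ cong (degInto S v +_) (degInto-⁅⁆ t v) ⟩
    degInto S v + e v t                                  ∎
    where
    open ≡-Reasoning
    part : (Fin n → Bool) → Fin n → ℕ
    part R u = if R u then e v u else 0
    parts : ∀ u → part T u ≡ part S u + part ⁅ t ⁆ u
    parts u rewrite T≡S∪t u with u ≟ t
    ... | yes refl rewrite St = refl
    ... | no _ rewrite Bool.∨-identityʳ (S u) = sym (+-identityʳ _)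

  walk-end : ∀ {Q x y} → Walk G Q x y → Q y
  walk-end (here qy)     = qy
  walk-end (step _ _ w)  = walk-end w

  walk-map : ∀ {Q R} → (∀ x → Q x → R x) → ∀ {x y} → Walk G Q x y → Walk G R x y
  walk-map Q⇒R (here qx)       = here (Q⇒R _ qx)
  walk-map Q⇒R (step qx exy w) = step (Q⇒R _ qx) exy (walk-map Q⇒R w)

  connectedOn-map : ∀ {Q R} → (∀ x → Q x → R x) → (∀ x → R x → Q x) →
                    ConnectedOn G Q → ConnectedOn G R
  connectedOn-map Q⇒R R⇒Q conn x y rx ry = walk-map Q⇒R (conn x y (R⇒Q x rx) (R⇒Q y ry))

  walk-avoid-or-approach : ∀ {Q R} t → (∀ z → Q z → z ≢ t → R z) → ∀ {x y} → Walk G Q x y → x ≢ t →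
                           Walk G R x y ⊎ ∃ λ z → Walk G R x z × 0 < e z t
  walk-avoid-or-approach t Q⇒R (here qx) x≢t = inj₁ (here (Q⇒R _ qx x≢t))
  walk-avoid-or-approach t Q⇒R (step {y = y} qx exy w) x≢t with y ≟ t
  ... | yes refl = inj₂ (_ , here (Q⇒R _ qx x≢t) , exy)
  ... | no y≢t with walk-avoid-or-approach t Q⇒R w y≢t
  ...   | inj₁ w′             = inj₁ (step (Q⇒R _ qx x≢t) exy w′)
  ...   | inj₂ (z , w′ , ezt) = inj₂ (z , step (Q⇒R _ qx x≢t) exy w′ , ezt)

-- Partial colourings of a cover

module Precolouring (G : Multigraph) {k : Fin (Multigraph.n G) → ℕ} (C : Cover G k) where
  open Multigraph G
  open Cover C

  neighbours-≤ : ∀ {u v} → u ≢ v → (c : Fin (k u)) → count (crossH u v c) ≤ e u v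
  neighbours-≤ {u} {v} u≢v c with matchings u v u≢v
  ... | M , isMatching , crossH⇔M = begin
    count (crossH u v c)                ≤⟨ count-mono (λ b h → any-intro (proj₁ (crossH⇔M c b) h)) ⟩
    count (λ b → any (λ i → M i c b))   ≤⟨ count-any (λ i → M i c) ⟩
    ∑[ i < e u v ] count (M i c)        ≤⟨ ∑-mono-≤ (λ i → count-≤1 (M i c) (proj₁ (isMatching i) c)) ⟩
    ∑[ i < e u v ] 1                    ≡⟨ count-⊤ ⟩
    e u v                               ∎
    where open ≤-Reasoning

  neighbours-≤′ : ∀ {u v} → u ≢ v → (c : Fin (k u)) → count (crossH u v c) ≤ e v u
  neighbours-≤′ {u} {v} u≢v c = ≤-trans (neighbours-≤ u≢v c) (≤-reflexive (e-sym u v))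

  PartialColouring : Set
  PartialColouring = (v : Fin n) → Maybe (Fin (k v))

  ∅ : PartialColouring
  ∅ _ = nothing

  infixl 6 _[_≔_]
  infix 4 _⊑_ _⊑_∪_

  _[_≔_] : PartialColouring → (p : Fin n) → Fin (k p) → PartialColouring
  (φ [ p ≔ c ]) v with v ≟ p
  ... | yes refl = just c
  ... | no _     = φ v

  dom : PartialColouring → Fin n → Bool
  dom φ v = is-just (φ v)

  _⊑_ : PartialColouring → PartialColouring → Set
  φ ⊑ ψ = ∀ v c → φ v ≡ just c → ψ v ≡ just c

  _⊑_∪_ : PartialColouring → PartialColouring → (Fin n → Bool) → Set
  ψ ⊑ φ ∪ T = ∀ v c → ψ v ≡ just c → φ v ≡ just c ⊎ T v ≡ true

  Independent : PartialColouring → Set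
  Independent φ = ∀ u v c d → u ≢ v → φ u ≡ just c → φ v ≡ just d → crossH u v c d ≡ false

  forbids : ∀ u v → Maybe (Fin (k u)) → Fin (k v) → Bool
  forbids u v nothing  b = false
  forbids u v (just c) b = crossH u v c b

  -- Meaningful only at an uncoloured v: the cover does not constrain crossH v v.
  forbidden : PartialColouring → (v : Fin n) → Fin (k v) → Bool
  forbidden φ v b = any (λ u → forbids u v (φ u) b)

  #forbidden : PartialColouring → Fin n → ℕ
  #forbidden φ v = count (forbidden φ v)

  #forbidden-≤ : ∀ {φ ψ T} v → ψ ⊑ φ ∪ T → ψ v ≡ nothing →
                 #forbidden ψ v ≤ #forbidden φ v + degInto G T v
  #forbidden-≤ {φ} {ψ} {T} v ψ⊑φ∪T ψv≡nothing = begin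
    #forbidden ψ v                                         ≤⟨ count-mono split ⟩
    count (λ b → forbidden φ v b ∨ any (λ u → newly u b))  ≤⟨ count-∨ (forbidden φ v) _ ⟩
    #forbidden φ v + count (λ b → any (λ u → newly u b))   ≤⟨ +-monoʳ-≤ _ (count-any newly) ⟩
    #forbidden φ v + ∑[ u < n ] count (newly u)            ≤⟨ +-monoʳ-≤ _ (∑-mono-≤ newly-≤) ⟩
    #forbidden φ v + degInto G T v                         ∎
    where
    open ≤-Reasoning
    newly : Fin n → Fin (k v) → Bool
    newly u b = T u ∧ forbids u v (ψ u) b
    split : ∀ b → forbidden ψ v b ≡ true → (forbidden φ v b ∨ any (λ u → newly u b)) ≡ true
    split b forbidden-b with any-elim forbidden-b
    ... | u , hit with ψ u in ψu
    ... | just c with ψ⊑φ∪T u c ψu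
    ...   | inj₁ φu = cong (_∨ _) (any-intro (u , subst (λ m → forbids u v m b ≡ true) (sym φu) hit))
    ...   | inj₂ Tu = trans (cong (forbidden φ v b ∨_) (any-intro (u , newly-u)))
                            (Bool.∨-zeroʳ _)
      where
      newly-u : newly u b ≡ true
      newly-u = subst₂ (λ t m → t ∧ forbids u v m b ≡ true) (sym Tu) (sym ψu) hit
    newly-≤ : ∀ u → count (newly u) ≤ (if T u then e v u else 0)
    newly-≤ u with T u | ψ u in ψu
    ... | false | _      = ≤-reflexive (count-∅ {k v})
    ... | true  | nothing = ≤-trans (≤-reflexive (count-∅ {k v})) z≤n
    ... | true  | just c = neighbours-≤′ u≢v c
      where
      u≢v : u ≢ v
      u≢v refl = contradiction (trans (sym ψu) ψv≡nothing) λ ()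

  [≔]-nothing : ∀ {φ p c x} → x ≢ p → φ x ≡ nothing → (φ [ p ≔ c ]) x ≡ nothing
  [≔]-nothing {p = p} {x = x} x≢p φx with x ≟ p
  ... | yes x≡p = contradiction x≡p x≢p
  ... | no _    = φx

  [≔]-nothing⁻¹ : ∀ {φ p c x} → (φ [ p ≔ c ]) x ≡ nothing → x ≢ p × φ x ≡ nothing
  [≔]-nothing⁻¹ {p = p} {x = x} φ′x with x ≟ p
  ... | yes refl = contradiction φ′x λ ()
  ... | no x≢p   = x≢p , φ′x

  dom-[≔] : ∀ {φ p c} u → dom (φ [ p ≔ c ]) u ≡ dom φ u ∨ ⁅ p ⁆ u
  dom-[≔] {φ} {p} u with u ≟ p
  ... | yes refl = sym (Bool.∨-zeroʳ (dom φ p))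
  ... | no _     = sym (Bool.∨-identityʳ (dom φ u))

  ⊑-[≔] : ∀ {φ p c} → φ p ≡ nothing → φ ⊑ φ [ p ≔ c ]
  ⊑-[≔] {p = p} φp u d φu with u ≟ p
  ... | yes refl = contradiction (trans (sym φu) φp) λ ()
  ... | no _     = φu

  forbidden-[≔] : ∀ {φ p c v b} → forbidden (φ [ p ≔ c ]) v b ≡ true →
                  forbidden φ v b ≡ true ⊎ crossH p v c b ≡ true
  forbidden-[≔] {p = p} forbidden-b with any-elim forbidden-b
  ... | u , hit with u ≟ p
  ... | yes refl = inj₂ hit
  ... | no _     = inj₁ (any-intro (u , hit))

  forbidden-∅ : ∀ v b → forbidden ∅ v b ≡ false
  forbidden-∅ v b with forbidden ∅ v b in forbidden-b
  ... | false = refl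
  ... | true  = contradiction (proj₂ (any-elim {n} {λ _ → false} forbidden-b)) λ ()

  #forbidden-∅ : ∀ v → #forbidden ∅ v ≡ 0
  #forbidden-∅ v = trans (sum-cong-≗ (cong indicator ∘ forbidden-∅ v)) (count-∅ {k v})

  degInto-dom-[≔] : ∀ {φ p c} v → φ p ≡ nothing →
                    degInto G (dom (φ [ p ≔ c ])) v ≡ degInto G (dom φ) v + e v p
  degInto-dom-[≔] {p = p} v φp = degInto-insert G p v dom-[≔] (cong is-just φp)

  independent-∅ : Independent ∅
  independent-∅ u v c d u≢v ()

  independent-[≔] : ∀ {φ p c} → Independent φ → (∀ u d → u ≢ p → φ u ≡ just d → crossH u p d c ≡ false) →
                    Independent (φ [ p ≔ c ])
  independent-[≔] {φ} {p} {c} φ-indep c-free u v c′ d′ u≢v φ′u φ′v with u ≟ p | v ≟ p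
  ... | yes refl | yes refl = contradiction refl u≢v
  ... | yes refl | no v≢p   rewrite sym (just-injective φ′u) =
    trans (crossH-sym u v c d′) (c-free v d′ v≢p φ′v)
  ... | no u≢p   | yes refl rewrite sym (just-injective φ′v) = c-free u c′ u≢p φ′u
  ... | no _     | no _     = φ-indep u v c′ d′ u≢v φ′u φ′v

  record Degenerate (φ : PartialColouring) (S : Fin n → Bool) : Set where
    field
      uncoloured : ∀ v → S v ≡ true → φ v ≡ nothing
      room       : ∀ v → S v ≡ true → #forbidden φ v + degInto G S v ≤ k v
      slack      : ∀ v → S v ≡ true →
                   ∃ λ s → Walk G (λ x → S x ≡ true) v s × #forbidden φ s + degInto G S s < k s

  record Extension (φ : PartialColouring) (S : Fin n → Bool) : Set where
    field
      colouring   : PartialColouring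
      extends     : φ ⊑ colouring
      covers      : ∀ v → S v ≡ true → ∃ λ c → colouring v ≡ just c
      within      : colouring ⊑ φ ∪ S
      independent : Independent colouring

  degenerate-∖ : ∀ {φ S s₀} → Degenerate φ S → S s₀ ≡ true → #forbidden φ s₀ + degInto G S s₀ < k s₀ →
                 Degenerate φ (S ∖ s₀)
  degenerate-∖ {φ} {S} {s₀} D Ss₀ slack₀ = record
    { uncoloured = λ v h → uncoloured v (∖-⊆ S s₀ v h)
    ; room       = λ v h → ≤-trans (+-monoʳ-≤ _ (degInto-mono G (∖-⊆ S s₀) v)) (room v (∖-⊆ S s₀ v h))
    ; slack      = slack′
    }
    where
    open Degenerate D
    slack′ : ∀ v → (S ∖ s₀) v ≡ true →
             ∃ λ s → Walk G (λ x → (S ∖ s₀) x ≡ true) v s × #forbidden φ s + degInto G (S ∖ s₀) s < k s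
    slack′ v h with slack v (∖-⊆ S s₀ v h)
    ... | s , walk , s-slack with walk-avoid-or-approach G s₀ (λ z Sz z≢s₀ → ∈-∖ S Sz z≢s₀) walk (∖-≢ S h)
    ...   | inj₁ walk′ = s , walk′ , ≤-<-trans (+-monoʳ-≤ _ (degInto-mono G (∖-⊆ S s₀) s)) s-slack
    ...   | inj₂ (z , walk′ , e-z-s₀) = z , walk′ , (begin-strict
      #forbidden φ z + degInto G (S ∖ s₀) z             <⟨ +-monoʳ-< (#forbidden φ z) (m<m+n _ e-z-s₀) ⟩
      #forbidden φ z + (degInto G (S ∖ s₀) z + e z s₀)  ≡⟨ cong (#forbidden φ z +_) S-degree ⟩
      #forbidden φ z + degInto G S z                    ≤⟨ room z (∖-⊆ S s₀ z (walk-end G walk′)) ⟩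
      k z                                               ∎)
      where
      open ≤-Reasoning
      S-degree : degInto G (S ∖ s₀) z + e z s₀ ≡ degInto G S z
      S-degree = sym (degInto-insert G s₀ z (∖-∪-⁅⁆ S Ss₀) (∖-self S s₀))

  extension-∖⇒extension : ∀ {φ S s₀} → Extension φ (S ∖ s₀) → S s₀ ≡ true → φ s₀ ≡ nothing →
                          #forbidden φ s₀ + degInto G (S ∖ s₀) s₀ < k s₀ → Extension φ S
  extension-∖⇒extension {φ} {S} {s₀} E Ss₀ φs₀ slack₀ = record
    { colouring   = ψ [ s₀ ≔ b ]
    ; extends     = λ v c φv → ⊑-[≔] ψs₀ v c (extends v c φv)
    ; covers      = covers′
    ; within      = within′
    ; independent = independent-[≔] independent b-free
    }
    where
    open Extension E renaming (colouring to ψ)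
    ψs₀ : ψ s₀ ≡ nothing
    ψs₀ with ψ s₀ in ψs₀≡
    ... | nothing = refl
    ... | just c with within s₀ c ψs₀≡
    ...   | inj₁ φs₀≡ = contradiction (trans (sym φs₀) φs₀≡) λ ()
    ...   | inj₂ s₀∈  = contradiction (trans (sym s₀∈) (∖-self S s₀)) λ ()
    free-colour : ∃ λ b → forbidden ψ s₀ b ≡ false
    free-colour with count-<⇒∃ {g = λ _ → true} (begin-strict
      #forbidden ψ s₀                          ≤⟨ #forbidden-≤ s₀ within ψs₀ ⟩
      #forbidden φ s₀ + degInto G (S ∖ s₀) s₀  <⟨ slack₀ ⟩
      k s₀                                     ≡⟨ count-⊤ ⟨
      count {k s₀} (λ _ → true)                ∎)
      where open ≤-Reasoning
    ... | b , _ , b-free = b , b-free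
    b = proj₁ free-colour
    b-free : ∀ u d → u ≢ s₀ → ψ u ≡ just d → crossH u s₀ d b ≡ false
    b-free u d _ ψu = subst (λ m → forbids u s₀ m b ≡ false) ψu (any-false (proj₂ free-colour) u)
    covers′ : ∀ v → S v ≡ true → ∃ λ c → (ψ [ s₀ ≔ b ]) v ≡ just c
    covers′ v Sv with v ≟ s₀
    ... | yes refl = b , refl
    ... | no v≢s₀  = covers v (∈-∖ S Sv v≢s₀)
    within′ : ψ [ s₀ ≔ b ] ⊑ φ ∪ S
    within′ v c ψ′v with v ≟ s₀
    ... | yes refl = inj₂ Ss₀
    ... | no _ with within v c ψ′v
    ...   | inj₁ φv = inj₁ φv
    ...   | inj₂ v∈ = inj₂ (∖-⊆ S s₀ v v∈)

  extend-greedily : ∀ N {φ S} → count S ≤ N → Independent φ → Degenerate φ S → Extension φ S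
  extend-greedily N {φ} {S} |S|≤N φ-indep D with any? (λ v → S v Bool.≟ true)
  ... | no S-empty = record
    { colouring   = φ
    ; extends     = λ _ _ → id
    ; covers      = λ v Sv → contradiction (v , Sv) S-empty
    ; within      = λ _ _ → inj₁
    ; independent = φ-indep
    }
  ... | yes (v , Sv) with Degenerate.slack D v Sv | N
  ...   | _ , _ , _ | zero =
    contradiction (≤-trans |S|≤N z≤n) (<⇒≱ (count-< {f = λ _ → false} (λ _ ()) v Sv refl))
  ...   | s₀ , walk , slack₀ | suc N′ =
    extension-∖⇒extension (extend-greedily N′ fewer φ-indep (degenerate-∖ D Ss₀ slack₀)) Ss₀
      (Degenerate.uncoloured D s₀ Ss₀) (≤-<-trans (+-monoʳ-≤ _ (degInto-mono G (∖-⊆ S s₀) s₀)) slack₀)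
    where
    Ss₀ : S s₀ ≡ true
    Ss₀ = walk-end G walk
    fewer : count (S ∖ s₀) ≤ N′
    fewer = ≤-pred (≤-trans (count-< (∖-⊆ S s₀) s₀ Ss₀ (∖-self S s₀)) |S|≤N)

  total⇒colouring : ∀ {ψ} → Independent ψ → (∀ v → ∃ λ c → ψ v ≡ just c) → Coloring
  total⇒colouring {ψ} ψ-indep total = f , cong proj₁ , non-adjacent
    where
    f : Fin n → Colour
    f v = v , proj₁ (total v)
    non-adjacent : ∀ i j → ¬ Adj (f i) (f j)
    non-adjacent i j (inj₁ (refl , fi≢fi)) = fi≢fi refl
    non-adjacent i j (inj₂ (i≢j , adjacent)) =
      contradiction (trans (sym adjacent) (ψ-indep i j _ _ i≢j (proj₂ (total i)) (proj₂ (total j)))) λ ()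

  precolouring⇒colouring : ∀ {φ} → Independent φ → ConnectedOn G (λ x → φ x ≡ nothing) →
                           (∀ v → deg G v ≤ k v) →
                           ∀ s → φ s ≡ nothing → #forbidden φ s < degInto G (dom φ) s → Coloring
  precolouring⇒colouring {φ} φ-indep conn deg≤k s φs slack-s = total⇒colouring independent total
    where
    U : Fin n → Bool
    U = not ∘ dom φ
    U⇒nothing : ∀ v → U v ≡ true → φ v ≡ nothing
    U⇒nothing v Uv with φ v
    ... | nothing = refl
    nothing⇒U : ∀ v → φ v ≡ nothing → U v ≡ true
    nothing⇒U v φv rewrite φv = refl
    #forbidden≤dom : ∀ v → φ v ≡ nothing → #forbidden φ v ≤ degInto G (dom φ) v
    #forbidden≤dom v φv = ≤-trans (#forbidden-≤ {∅} v (λ u c φu → inj₂ (cong is-just φu)) φv)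
                                  (≤-reflexive (cong (_+ degInto G (dom φ) v) (#forbidden-∅ v)))
    budget : ∀ v → degInto G (dom φ) v + degInto G U v ≤ k v
    budget v = ≤-trans (≤-reflexive (deg-split G (dom φ) v)) (deg≤k v)
    D : Degenerate φ U
    D = record
      { uncoloured = U⇒nothing
      ; room       = λ v Uv → ≤-trans (+-monoˡ-≤ _ (#forbidden≤dom v (U⇒nothing v Uv))) (budget v)
      ; slack      = λ v Uv → s , walk-map G nothing⇒U (conn v s (U⇒nothing v Uv) φs)
                            , <-≤-trans (+-monoˡ-< _ slack-s) (budget s)
      }
    open Extension (extend-greedily n (count-≤ U) φ-indep D)
    total : ∀ v → ∃ λ c → colouring v ≡ just c
    total v with φ v in φv
    ... | just c  = c , extends v c φv
    ... | nothing = covers v (nothing⇒U v φv)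

  precolour-one⇒colouring : ∀ {p} (c : Fin (k p)) → ConnectedOn G (λ x → x ≢ p) → (∀ v → deg G v ≤ k v) →
                            ∀ s → s ≢ p → count (crossH p s c) < e s p → Coloring
  precolour-one⇒colouring {p} c conn deg≤k s s≢p few =
    precolouring⇒colouring φ-indep conn′ deg≤k s ([≔]-nothing s≢p refl) (begin-strict
      #forbidden φ s                ≤⟨ count-mono forbidden⊆ ⟩
      count (crossH p s c)          <⟨ few ⟩
      e s p                         ≡⟨ cong (_+ e s p) (degInto-∅ G s) ⟨
      degInto G (dom ∅) s + e s p   ≡⟨ degInto-dom-[≔] s refl ⟨
      degInto G (dom φ) s           ∎)
    where
    open ≤-Reasoning
    φ : PartialColouring
    φ = ∅ [ p ≔ c ]
    φ-indep : Independent φ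
    φ-indep = independent-[≔] independent-∅ (λ _ _ _ ())
    conn′ : ConnectedOn G (λ x → φ x ≡ nothing)
    conn′ = connectedOn-map G (λ x x≢p → [≔]-nothing x≢p refl) (λ x φx → proj₁ ([≔]-nothing⁻¹ φx)) conn
    forbidden⊆ : forbidden φ s ⊆ crossH p s c
    forbidden⊆ b forbidden-b with forbidden-[≔] forbidden-b
    ... | inj₁ forbidden-∅-b = contradiction (trans (sym forbidden-∅-b) (forbidden-∅ s b)) λ ()
    ... | inj₂ adjacent      = adjacent

  precolour-two⇒colouring : ∀ {p₁ p₂} → p₁ ≢ p₂ → (c₁ : Fin (k p₁)) (c₂ : Fin (k p₂)) →
                            crossH p₁ p₂ c₁ c₂ ≡ false →
                            ConnectedOn G (λ x → x ≢ p₁ × x ≢ p₂) → (∀ v → deg G v ≤ k v) →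
                            ∀ s → s ≢ p₁ → s ≢ p₂ →
                            count (λ b → crossH p₁ s c₁ b ∨ crossH p₂ s c₂ b) < e s p₁ + e s p₂ → Coloring
  precolour-two⇒colouring {p₁} {p₂} p₁≢p₂ c₁ c₂ c₁≁c₂ conn deg≤k s s≢p₁ s≢p₂ few =
    precolouring⇒colouring φ-indep conn′ deg≤k s ([≔]-nothing s≢p₂ ([≔]-nothing s≢p₁ refl))
      (begin-strict
      #forbidden φ s                                       ≤⟨ count-mono forbidden⊆ ⟩
      count (λ b → crossH p₁ s c₁ b ∨ crossH p₂ s c₂ b)    <⟨ few ⟩
      e s p₁ + e s p₂                                      ≡⟨ cong (λ d → d + e s p₁ + e s p₂) (degInto-∅ G s) ⟨
      degInto G (dom ∅) s + e s p₁ + e s p₂                ≡⟨ cong (_+ e s p₂) (degInto-dom-[≔] s refl) ⟨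
      degInto G (dom φ₁) s + e s p₂                        ≡⟨ degInto-dom-[≔] s ([≔]-nothing (p₁≢p₂ ∘ sym) refl) ⟨
      degInto G (dom φ) s                                  ∎)
    where
    open ≤-Reasoning
    φ₁ φ : PartialColouring
    φ₁ = ∅ [ p₁ ≔ c₁ ]
    φ  = φ₁ [ p₂ ≔ c₂ ]
    c₂-free : ∀ u d → u ≢ p₂ → φ₁ u ≡ just d → crossH u p₂ d c₂ ≡ false
    c₂-free u d _ φ₁u with u ≟ p₁
    ... | yes refl rewrite sym (just-injective φ₁u) = c₁≁c₂
    ... | no _     = contradiction φ₁u λ ()
    φ-indep : Independent φ
    φ-indep = independent-[≔] (independent-[≔] independent-∅ (λ _ _ _ ())) c₂-free
    conn′ : ConnectedOn G (λ x → φ x ≡ nothing)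
    conn′ = connectedOn-map G
      (λ x (x≢p₁ , x≢p₂) → [≔]-nothing x≢p₂ ([≔]-nothing x≢p₁ refl))
      (λ x φx → let x≢p₂ , φ₁x = [≔]-nothing⁻¹ φx in proj₁ ([≔]-nothing⁻¹ φ₁x) , x≢p₂)
      conn
    forbidden⊆ : forbidden φ s ⊆ (λ b → crossH p₁ s c₁ b ∨ crossH p₂ s c₂ b)
    forbidden⊆ b forbidden-b with forbidden-[≔] forbidden-b
    ... | inj₂ adjacent₂ = trans (cong (crossH p₁ s c₁ b ∨_) adjacent₂) (Bool.∨-zeroʳ _)
    ... | inj₁ forbidden₁-b with forbidden-[≔] forbidden₁-b
    ...   | inj₂ adjacent₁ = cong (_∨ crossH p₂ s c₂ b) adjacent₁
    ...   | inj₁ forbidden-∅-b = contradiction (trans (sym forbidden-∅-b) (forbidden-∅ s b)) λ ()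

lemma7 : (G : Multigraph) → TwoConnected G →
         (u₁ u₂ w : Fin (Multigraph.n G)) →
         u₁ ≢ u₂ → u₁ ≢ w → u₂ ≢ w →
         ConnectedOn G (λ x → x ≢ u₁ × x ≢ u₂) →
         Multigraph.e G u₁ u₂ < Multigraph.e G u₁ w →
         1 ≤ Multigraph.e G u₂ w →
         DPDegreeColorable G
lemma7 G (_ , _ , no-cut-vertex) u₁ u₂ w u₁≢u₂ u₁≢w u₂≢w conn e₁₂<e₁w e₂w≥1 k deg≤k C = colouring
  where
  open Multigraph G
  open Cover C
  open Precolouring G C
  open ≤-Reasoning
  c₂ : Fin (k u₂)
  c₂ = fromℕ< (≤-trans e₂w≥1 (≤-trans (e≤deg G u₂ w) (deg≤k u₂)))
  colouring : Coloring
  colouring with any? (λ x → count (crossH w u₁ x) <? e u₁ w)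
  ... | yes (x , few) = precolour-one⇒colouring x (no-cut-vertex w) deg≤k u₁ u₁≢w few
  ... | no many with any? (λ x → crossH u₂ w c₂ x Bool.≟ true)
  ...   | no c₂-isolated = precolour-one⇒colouring c₂ (no-cut-vertex u₂) deg≤k w (u₂≢w ∘ sym) (begin-strict
          count (crossH u₂ w c₂)     ≡⟨ count-∄ c₂-isolated ⟩
          0                          <⟨ e₂w≥1 ⟩
          e u₂ w                     ≡⟨ e-sym u₂ w ⟩
          e w u₂                     ∎)
  ...   | yes (x , c₂~x) with count-<⇒∃ (begin-strict
          count (crossH u₂ u₁ c₂)    ≤⟨ neighbours-≤′ (u₁≢u₂ ∘ sym) c₂ ⟩
          e u₁ u₂                    <⟨ e₁₂<e₁w ⟩
          e u₁ w                     ≤⟨ ≮⇒≥ (λ few → many (x , few)) ⟩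
          count (crossH w u₁ x)      ∎)
  ...     | c₁ , x~c₁ , c₂≁c₁ =
    precolour-two⇒colouring u₁≢u₂ c₁ c₂ (trans (crossH-sym u₁ u₂ c₁ c₂) c₂≁c₁) conn deg≤k w (u₁≢w ∘ sym) (u₂≢w ∘ sym)
      (begin-strict
        count (λ b → crossH u₁ w c₁ b ∨ crossH u₂ w c₂ b)
          <⟨ count-∨-< (crossH u₁ w c₁) (crossH u₂ w c₂) x (trans (crossH-sym u₁ w c₁ x) x~c₁) c₂~x ⟩
        count (crossH u₁ w c₁) + count (crossH u₂ w c₂)
          ≤⟨ +-mono-≤ (neighbours-≤′ u₁≢w c₁) (neighbours-≤′ u₂≢w c₂) ⟩
        e w u₁ + e w u₂
          ∎)
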